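{- Let $s$ be a positive integer and $H$ a graph, and let $n\ge 2s-1$. (i) If every vertex of $H$ has degree at least $s$, then $\mathrm{ex}(n,H,M_s)=\mathcal{N}(H,K_{2s-1})$. (ii) If every vertex of $H$ has degree at least $s$ except one vertex, which has degree $s-1$, then $$\mathrm{ex}(n,H,M_s)=\max\{\mathcal{N}(H,H(n,2s-1,s-1)),\ \mathcal{N}(H,K_{2s-1})\}.$$
   Context: $M_s$ is the matching with $s$ pairwise vertex-disjoint edges and $K_m$ the complete graph on $m$ vertices. For integers $n,k,a$, $H(n,k,a)$ is the graph on disjoint vertex sets $A$ of order $a$, $B$ of order $n-k+a$ and $C$ of order $k-2a$, with all edges between $A$ and $B$ and all edges inside $A\cup C$ (so $H(n,2s-1,s-1)$ is a clique on $s-1$ vertices completely joined to an independent set of $n-s+1$ vertices). $\mathcal{N}(H,G)$ is the number of subgraphs of $G$ isomorphic to $H$; $\mathrm{ex}(n,H,F)$ is the maximum of $\mathcal{N}(H,G)$ over $n$-vertex graphs $G$ with no subgraph isomorphic to $F$. -}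

module Defs where

open import Data.Nat using (ℕ; zero; suc; _+_; _*_; _∸_; _≤_; _<ᵇ_; _≤ᵇ_; _≡ᵇ_)
open import Data.Fin using (Fin; toℕ; _≟_)
open import Data.Bool using (Bool; true; false; _∧_; _∨_; not)
import Data.Bool as B
open import Data.Bool.Properties using (∧-zeroʳ; ∨-comm)
open import Data.Vec using (Vec; []; _∷_; lookup; tabulate)
import Data.Vec.Properties as VP
import Data.Product.Properties as PP
open import Data.List using (List; [_]; map; concatMap; length; filterᵇ; deduplicate; allFin)
open import Data.Bool.ListAction using (any; all)
open import Data.Product using (Σ; _×_; _,_)
open import Data.Empty using (⊥-elim)
open import Relation.Nullary using (¬_; yes; no)
open import Relation.Nullary.Decidable using (⌊_⌋)
open import Relation.Binary.PropositionalEquality using (_≡_; refl; cong; cong₂)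
open import Function.Definitions using (Injective)

record Graph (n : ℕ) : Set where
  field
    adj    : Fin n → Fin n → Bool
    sym    : ∀ i j → adj i j ≡ adj j i
    irrefl : ∀ i → adj i i ≡ false
open Graph public

deg : ∀ {n} → Graph n → Fin n → ℕ
deg {n} G v = length (filterᵇ (adj G v) (allFin n))

≟-sym : ∀ {n} (i j : Fin n) → ⌊ i ≟ j ⌋ ≡ ⌊ j ≟ i ⌋
≟-sym i j with i ≟ j | j ≟ i
... | yes _    | yes _ = refl
... | no _     | no _  = refl
... | yes refl | no ¬p = ⊥-elim (¬p refl)
... | no ¬p    | yes refl = ⊥-elim (¬p refl)

≟-refl : ∀ {n} (i : Fin n) → ⌊ i ≟ i ⌋ ≡ true
≟-refl i with i ≟ i
... | yes _ = refl
... | no ¬p = ⊥-elim (¬p refl)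

fromRel : ∀ {n} → (Fin n → Fin n → Bool) → Graph n
fromRel r = record
  { adj    = λ i j → (r i j ∨ r j i) ∧ not ⌊ i ≟ j ⌋
  ; sym    = λ i j → cong₂ _∧_ (∨-comm (r i j) (r j i)) (cong not (≟-sym i j))
  ; irrefl = λ i → helper i
  }
  where
  helper : ∀ i → (r i i ∨ r i i) ∧ not ⌊ i ≟ i ⌋ ≡ false
  helper i rewrite ≟-refl i = ∧-zeroʳ (r i i ∨ r i i)

K : (m : ℕ) → Graph m
K m = fromRel (λ _ _ → true)

M : (s : ℕ) → Graph (s + s)
M s = fromRel (λ i j → (toℕ i + s) ≡ᵇ toℕ j)

-- H(n,k,a): vertex set Fin n split as
--   A = [0, a),  B = [a, a + (n - k + a)),  C = the remaining k - 2a vertices;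
-- all A–B edges and all edges inside A ∪ C.
Hnka : (n k a : ℕ) → Graph n
Hnka n k a = fromRel r
  where
  inA : Fin n → Bool
  inA i = toℕ i <ᵇ a
  inB : Fin n → Bool
  inB i = (a ≤ᵇ toℕ i) ∧ (toℕ i <ᵇ (a + ((n ∸ k) + a)))
  r : Fin n → Fin n → Bool
  r i j = (inA i ∧ inB j) ∨ (not (inB i) ∧ not (inB j))

Contains : ∀ {f n} → Graph f → Graph n → Set
Contains {f} {n} F G =
  Σ (Fin f → Fin n) λ φ → Injective _≡_ _≡_ φ ×
    (∀ i j → adj F i j ≡ true → adj G (φ i) (φ j) ≡ true)

-- A subgraph of G isomorphic to H is exactly the image
-- (vertex set φ[V(H)], edge set φ[E(H)]) of an embedding
-- (injective edge-preserving map) φ : V(H) → V(G); we count the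
-- distinct such images (vertex set as a Boolean vector, edge set as
-- a Boolean adjacency matrix).

allVecs : ∀ {A : Set} → List A → (h : ℕ) → List (Vec A h)
allVecs xs zero    = [ [] ]
allVecs xs (suc h) = concatMap (λ x → map (x ∷_) (allVecs xs h)) xs

pairs : (h : ℕ) → List (Fin h × Fin h)
pairs h = concatMap (λ i → map (λ j → (i , j)) (allFin h)) (allFin h)

isEmbedding : ∀ {h n} → Graph h → Graph n → Vec (Fin n) h → Bool
isEmbedding {h} H G φ = all ok (pairs h)
  where
  ok : Fin h × Fin h → Bool
  ok (i , j) = (⌊ i ≟ j ⌋ ∨ not ⌊ lookup φ i ≟ lookup φ j ⌋)
             ∧ (not (adj H i j) ∨ adj G (lookup φ i) (lookup φ j))

Image : ℕ → Set
Image n = Vec Bool n × Vec (Vec Bool n) n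

image : ∀ {h n} → Graph h → Vec (Fin n) h → Image n
image {h} {n} H φ =
  ( tabulate (λ v → any (λ i → ⌊ lookup φ i ≟ v ⌋) (allFin h))
  , tabulate (λ u → tabulate (λ v → any (λ p → edgeTo p u v) (pairs h))) )
  where
  edgeTo : Fin h × Fin h → Fin n → Fin n → Bool
  edgeTo (i , j) u v = adj H i j ∧ ⌊ lookup φ i ≟ u ⌋ ∧ ⌊ lookup φ j ≟ v ⌋

_≟Img_ : ∀ {n} (x y : Image n) → Relation.Nullary.Dec (x ≡ y)
_≟Img_ = PP.≡-dec (VP.≡-dec B._≟_) (VP.≡-dec (VP.≡-dec B._≟_))

numCopies : ∀ {h n} → Graph h → Graph n → ℕ
numCopies {h} {n} H G =
  length (deduplicate _≟Img_
           (map (image H) (filterᵇ (isEmbedding H G) (allVecs (allFin n) h))))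

IsEx : (n : ℕ) → ∀ {h f} → Graph h → Graph f → ℕ → Set
IsEx n H F v =
  (∀ (G : Graph n) → ¬ Contains F G → numCopies H G ≤ v) ×
  Σ (Graph n) (λ G → ¬ Contains F G × numCopies H G ≡ v)

{-# OPTIONS --safe #-}
-- Call a vertex of G active if it lies in a copy of H. Every copy of H lives in the
-- subgraph G[P] induced by the active vertices, and an active vertex has at least as
-- many active neighbours as its preimage has in H. Any map of P into another graph G′
-- that is injective and preserves the edges of G[P] therefore gives N(H,G) ≤ N(H,G′);
-- if |P| ≤ 2s − 1 we map P into K_{2s−1}.
--
-- Otherwise, in (i) every active vertex has at least s active neighbours, and a greedy
-- augmenting-path argument finds s disjoint edges in G[P], contradicting M_s-freeness.
-- In (ii) the same argument gives a maximum matching x_i y_i (i < s − 1) of G[P] that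
-- leaves two active vertices unmatched. Unmatched vertices have at most s − 1 active
-- neighbours, so they can only be images of the exceptional vertex of H, and exchange
-- arguments show that an unmatched vertex u₀ can be chosen adjacent to one end x_i of
-- every matching edge and that every edge of G[P] meets {x_i}. Sending the x_i to the
-- s − 1 universal vertices of H(n, 2s−1, s−1) then embeds G[P] there. Both bounds are
-- attained: by K_{2s−1} plus isolated vertices and by H(n, 2s−1, s−1), neither of which
-- contains M_s.

module Submission where

open import Defs hiding (sym)
open import Data.Nat using (ℕ; _+_; _*_; _∸_; _≤_; _⊔_)
open import Data.Fin using (Fin)
open import Data.Product using (Σ; _×_)
open import Relation.Binary.PropositionalEquality using (_≡_; _≢_)

open import Data.Bool using (Bool; true; false; _∧_; _∨_; not; T; if_then_else_)
import Data.Bool as Bool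
open import Data.Bool.ListAction using (any; or)
open import Data.Bool.Properties using (T-≡; T-∧; ¬-not)
open import Data.Empty using (⊥; ⊥-elim)
open import Data.Fin using (zero; suc; _≟_; toℕ; fromℕ<; inject≤; _↑ˡ_; _↑ʳ_; splitAt; join)
open import Data.Fin.Properties
  using (all?; any?; toℕ<n; toℕ-injective; toℕ-fromℕ<; toℕ-inject≤; inject≤-injective; injective⇒≤;
         toℕ-↑ˡ; toℕ-↑ʳ; splitAt-↑ˡ; splitAt-↑ʳ; splitAt⁻¹-↑ˡ; splitAt⁻¹-↑ʳ; join-splitAt)
import Data.List as List
open import Data.List using (List; []; _∷_; _++_; length; map; filter; filterᵇ; deduplicate; allFin)
open import Data.List.Properties using (length-map; length-++; length-tabulate; length-removeAt′; map-cong)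
open import Data.List.Membership.Propositional using (_∈_; _∉_; _─_; find; lose)
open import Data.List.Membership.Propositional.Properties
  using (∈-map⁺; ∈-map⁻; ∈-filter⁺; ∈-filter⁻; ∈-++⁺ˡ; ∈-++⁺ʳ; ∈-++⁻; ∈-tabulate⁺; ∈-tabulate⁻;
         ∈-allFin; ∈-concatMap⁺; ∈-deduplicate⁺; ∈-deduplicate⁻)
open import Data.List.Relation.Binary.Subset.Propositional using (_⊆_)
open import Data.List.Relation.Unary.All as All using (All; []; _∷_)
open import Data.List.Relation.Unary.All.Properties using (all⁺; all⁻) renaming (map⁺ to All-map⁺)
open import Data.List.Relation.Unary.AllPairs using (AllPairs; []; _∷_)
import Data.List.Relation.Unary.AllPairs.Properties as AllPairs
open import Data.List.Relation.Unary.Any as Any using (Any; here; there; index)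
open import Data.List.Relation.Unary.Any.Properties using (any⁻; lookup-index)
open import Data.List.Relation.Unary.Unique.Propositional using (Unique)
import Data.List.Relation.Unary.Unique.Propositional.Properties as Unique
open import Data.List.Relation.Unary.Unique.DecPropositional.Properties using (deduplicate-!)
open import Data.Nat using (zero; suc; _<_; z≤n; s≤s; s≤s⁻¹; _<ᵇ_; _≤ᵇ_; _≡ᵇ_; _<?_)
open import Data.Nat.Properties
  using (≤-refl; ≤-reflexive; ≤-trans; ≤-antisym; <⇒≤; <⇒≱; ≮⇒≥; ≰⇒>; ≤-<-trans; <-≤-trans; _≤?_;
         n≤1+n; m≤m+n; +-comm; +-suc; +-identityʳ; +-commutativeSemigroup;
         +-mono-≤; +-mono-<; +-mono-<-≤; +-cancelʳ-≤; +-cancelʳ-<; m∸n+n≡m;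
         m≤m⊔n; m≤n⊔m; m≥n⇒m⊔n≡m; m≤n⇒m⊔n≡n; <⇒<ᵇ; <ᵇ⇒<; ≤⇒≤ᵇ; ≤ᵇ⇒≤; ≡⇒≡ᵇ; ≡ᵇ⇒≡;
         module ≤-Reasoning)
open import Data.Nat.Solver using (module +-*-Solver)
open import Algebra.Properties.CommutativeSemigroup +-commutativeSemigroup using (interchange)
open import Data.Product using (_,_; proj₁; proj₂)
import Data.Product as Product
open import Data.Sum using (_⊎_; inj₁; inj₂; [_,_]; [_,_]′)
open import Data.Vec using (Vec; []; _∷_; lookup; tabulate)
import Data.Vec as V
open import Data.Vec.Properties using (tabulate-cong; lookup∘tabulate; lookup-map)
open import Data.Vec.Functional using (updateAt)
open import Data.Vec.Functional.Properties using (updateAt-updates; updateAt-minimal)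
open import Function using (_∘_; const; id)
open import Function.Bundles using (Equivalence)
open import Function.Definitions using (Injective)
open import Relation.Binary.Definitions using (DecidableEquality)
open import Relation.Binary.PropositionalEquality
  using (refl; sym; trans; cong; cong₂; subst; _≗_; module ≡-Reasoning)
open import Relation.Nullary using (¬_; yes; no; Dec; ¬?)
open import Relation.Nullary.Decidable using (⌊_⌋; T?; toWitness; _×-dec_; _⊎-dec_)
open import Relation.Unary using (Decidable)

module _ {A : Set} where

  ∈-─⁺ : ∀ {x y : A} {ys} (x∈ys : x ∈ ys) → y ∈ ys → y ≢ x → y ∈ ys ─ x∈ys
  ∈-─⁺ (here refl) (here refl) y≢x = ⊥-elim (y≢x refl)
  ∈-─⁺ (here _)    (there y∈)  _   = y∈
  ∈-─⁺ (there _)   (here refl) _   = here refl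
  ∈-─⁺ (there x∈)  (there y∈)  y≢x = there (∈-─⁺ x∈ y∈ y≢x)

  Unique⇒length≤ : ∀ {xs ys : List A} → Unique xs → xs ⊆ ys → length xs ≤ length ys
  Unique⇒length≤ {[]}     _              _     = z≤n
  Unique⇒length≤ {x ∷ xs} {ys} (x∉xs ∷ !xs) xs⊆ys = begin
    suc (length xs)          ≤⟨ s≤s (Unique⇒length≤ !xs step) ⟩
    suc (length (ys ─ x∈ys)) ≡⟨ sym (length-removeAt′ ys (index x∈ys)) ⟩
    length ys                ∎
    where
    open ≤-Reasoning
    x∈ys : x ∈ ys
    x∈ys = xs⊆ys (here refl)
    step : xs ⊆ ys ─ x∈ys
    step y∈xs = ∈-─⁺ x∈ys (xs⊆ys (there y∈xs)) (λ y≡x → All.lookup x∉xs y∈xs (sym y≡x))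

two-distinct : ∀ {A : Set} {xs : List A} → Unique xs → 2 ≤ length xs →
  Σ A λ a → Σ A λ b → a ≢ b × a ∈ xs × b ∈ xs
two-distinct {xs = a ∷ b ∷ _} ((a≢b ∷ _) ∷ _) _ = a , b , a≢b , here refl , there (here refl)
two-distinct {xs = _ ∷ []} _ (s≤s ())

Unique-Fin⇒length≤ : ∀ {k} {xs : List (Fin k)} → Unique xs → length xs ≤ k
Unique-Fin⇒length≤ {k} !xs =
  ≤-trans (Unique⇒length≤ !xs (λ {i} _ → ∈-allFin i)) (≤-reflexive (length-tabulate {n = k} (λ i → i)))

module _ {k} {P Q : Fin k → Set} (P? : Decidable P) (Q? : Decidable Q) (P⇒¬Q : ∀ {i} → P i → ¬ Q i) where

  private
    Ps Qs : List (Fin k)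
    Ps = filter P? (allFin k)
    Qs = filter Q? (allFin k)

    Ps++Qs-unique : Unique (Ps ++ Qs)
    Ps++Qs-unique = Unique.++⁺ (Unique.filter⁺ P? (Unique.allFin⁺ k)) (Unique.filter⁺ Q? (Unique.allFin⁺ k))
      (λ (i∈Ps , i∈Qs) → P⇒¬Q (proj₂ (∈-filter⁻ P? {xs = allFin k} i∈Ps))
                              (proj₂ (∈-filter⁻ Q? {xs = allFin k} i∈Qs)))

  length-filter-disjoint≤ : length (filter P? (allFin k)) + length (filter Q? (allFin k)) ≤ k
  length-filter-disjoint≤ = subst (_≤ k) (length-++ Ps) (Unique-Fin⇒length≤ Ps++Qs-unique)

  length-filter-disjoint< : ∀ i → ¬ P i → ¬ Q i → length (filter P? (allFin k)) + length (filter Q? (allFin k)) < k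
  length-filter-disjoint< i ¬Pi ¬Qi = subst (λ l → suc l ≤ k) (length-++ Ps)
    (Unique-Fin⇒length≤ (All.tabulate i∉ ∷ Ps++Qs-unique))
    where
    i∉ : ∀ {j} → j ∈ Ps ++ Qs → i ≢ j
    i∉ j∈ refl with ∈-++⁻ Ps j∈
    ... | inj₁ i∈Ps = ¬Pi (proj₂ (∈-filter⁻ P? {xs = allFin k} i∈Ps))
    ... | inj₂ i∈Qs = ¬Qi (proj₂ (∈-filter⁻ Q? {xs = allFin k} i∈Qs))

index-++ˡ : ∀ {A : Set} {v : A} xs {ys} (v∈ : v ∈ xs ++ ys) → v ∉ ys → toℕ (index v∈) < length xs
index-++ˡ []       v∈         v∉ys = ⊥-elim (v∉ys v∈)
index-++ˡ (x ∷ xs) (here _)   _    = s≤s z≤n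
index-++ˡ (x ∷ xs) (there v∈) v∉ys = s≤s (index-++ˡ xs v∈ v∉ys)

module _ {A C : Set} (_≟_ : DecidableEquality C) (p : A → C) where

  deduplicate-map : ∀ xs → map p (deduplicate (λ a b → p a ≟ p b) xs) ≡ deduplicate _≟_ (map p xs)
  deduplicate-map []       = refl
  deduplicate-map (a ∷ xs) = cong (p a ∷_) (begin
    map p (filter (¬? ∘ (λ b → p a ≟ p b)) (deduplicate _ xs)) ≡⟨ map-filter (deduplicate _ xs) ⟩
    filter (¬? ∘ (p a ≟_)) (map p (deduplicate _ xs))        ≡⟨ cong (filter (¬? ∘ (p a ≟_))) (deduplicate-map xs) ⟩
    filter (¬? ∘ (p a ≟_)) (deduplicate _≟_ (map p xs))      ∎)
    where
    open ≡-Reasoning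
    map-filter : ∀ ys → map p (filter (¬? ∘ (λ b → p a ≟ p b)) ys) ≡ filter (¬? ∘ (p a ≟_)) (map p ys)
    map-filter []       = refl
    map-filter (y ∷ ys) with p a ≟ p y
    ... | yes _ = map-filter ys
    ... | no  _ = cong (p y ∷_) (map-filter ys)

module _ {A B C D : Set} (_≟C_ : DecidableEquality C) (_≟D_ : DecidableEquality D)
         (p : A → C) (q : B → D) where

  length-deduplicate-map-≤ : ∀ {xs ys} (g : A → B) → (∀ {a} → a ∈ xs → g a ∈ ys) →
    (∀ {a b} → a ∈ xs → b ∈ xs → q (g a) ≡ q (g b) → p a ≡ p b) →
    length (deduplicate _≟C_ (map p xs)) ≤ length (deduplicate _≟D_ (map q ys))
  length-deduplicate-map-≤ {xs} {ys} g g∈ reflect = begin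
    length (deduplicate _≟C_ (map p xs)) ≡⟨ cong length (sym (deduplicate-map _≟C_ p xs)) ⟩
    length (map p reps)                  ≡⟨ length-map p reps ⟩
    length reps                          ≡⟨ sym (length-map (q ∘ g) reps) ⟩
    length (map (q ∘ g) reps)            ≤⟨ Unique⇒length≤ (distinct (∈-deduplicate⁻ _ xs) reps-distinct) images⊆ ⟩
    length (deduplicate _≟D_ (map q ys)) ∎
    where
    open ≤-Reasoning
    -- reps keeps one element of xs for each value of p, and q ∘ g keeps them apart.
    reps : List A
    reps = deduplicate (λ a b → p a ≟C p b) xs
    reps-distinct : AllPairs (λ a b → p a ≢ p b) reps
    reps-distinct = AllPairs.map⁻ (subst (AllPairs _≢_) (sym (deduplicate-map _≟C_ p xs)) (deduplicate-! _≟C_ (map p xs)))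
    distinct : ∀ {zs} → zs ⊆ xs → AllPairs (λ a b → p a ≢ p b) zs → Unique (map (q ∘ g) zs)
    distinct {[]}     _   []             = []
    distinct {a ∷ zs} zs⊆ (pa≢ ∷ !zs) =
      All-map⁺ (All.tabulate (λ b∈ e → All.lookup pa≢ b∈ (reflect (zs⊆ (here refl)) (zs⊆ (there b∈)) e)))
      ∷ distinct (zs⊆ ∘ there) !zs
    images⊆ : map (q ∘ g) reps ⊆ deduplicate _≟D_ (map q ys)
    images⊆ z∈ with ∈-map⁻ (q ∘ g) z∈
    ... | a , a∈ , refl = ∈-deduplicate⁺ _≟D_ (∈-map⁺ q (g∈ (∈-deduplicate⁻ _ xs a∈)))

false≢true : false ≢ true
false≢true ()

T-not-∨⇒ : ∀ {a b} → T (not a ∨ b) → a ≡ true → b ≡ true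
T-not-∨⇒ t refl = Equivalence.to T-≡ t

Bool-≡-via : ∀ {C : Set} {a b : Bool} → (a ≡ true → C) → (b ≡ true → C) → (C → a ≡ b) → a ≡ b
Bool-≡-via {a = false} {false} _  _  _ = refl
Bool-≡-via {a = true}          ta _  k = k (ta refl)
Bool-≡-via {a = false} {true}  _  tb k = k (tb refl)

<ᵇ-true : ∀ {m n} → m < n → (m <ᵇ n) ≡ true
<ᵇ-true = Equivalence.to T-≡ ∘ <⇒<ᵇ

<ᵇ-false : ∀ {m n} → ¬ m < n → (m <ᵇ n) ≡ false
<ᵇ-false {m} {n} m≮n = ¬-not (m≮n ∘ <ᵇ⇒< m n ∘ Equivalence.from T-≡)

≤ᵇ-true : ∀ {m n} → m ≤ n → (m ≤ᵇ n) ≡ true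
≤ᵇ-true = Equivalence.to T-≡ ∘ ≤⇒≤ᵇ

≤ᵇ-false : ∀ {m n} → ¬ m ≤ n → (m ≤ᵇ n) ≡ false
≤ᵇ-false {m} {n} m≰n = ¬-not (m≰n ∘ ≤ᵇ⇒≤ m n ∘ Equivalence.from T-≡)

∈-pairs : ∀ {h} (i j : Fin h) → (i , j) ∈ pairs h
∈-pairs {h} i j =
  ∈-concatMap⁺ (λ i → map (i ,_) (allFin h)) (Any.map (λ { refl → ∈-map⁺ (i ,_) (∈-allFin j) }) (∈-allFin i))

∈-allVecs : ∀ {A : Set} {xs : List A} → (∀ x → x ∈ xs) → ∀ {h} (v : Vec A h) → v ∈ allVecs xs h
∈-allVecs         all∈ []            = here refl
∈-allVecs {xs = xs} all∈ {suc h} (x ∷ v) =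
  ∈-concatMap⁺ (λ y → map (y ∷_) (allVecs xs h)) (Any.map (λ { refl → ∈-map⁺ (x ∷_) (∈-allVecs all∈ v) }) (all∈ x))

IsEmbedding : ∀ {h n} → Graph h → Graph n → (Fin h → Fin n) → Set
IsEmbedding H G f = Injective _≡_ _≡_ f × (∀ i j → adj H i j ≡ true → adj G (f i) (f j) ≡ true)

embeddings : ∀ {h n} → Graph h → Graph n → List (Vec (Fin n) h)
embeddings {h} {n} H G = filterᵇ (isEmbedding H G) (allVecs (allFin n) h)

module _ {h n} (H : Graph h) (G : Graph n) where

  private
    pairOk : (Fin h → Fin n) → Fin h × Fin h → Bool
    pairOk f (i , j) = (⌊ i ≟ j ⌋ ∨ not ⌊ f i ≟ f j ⌋) ∧ (not (adj H i j) ∨ adj G (f i) (f j))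

    pairOk-sound : ∀ f i j → T (pairOk f (i , j)) →
      (f i ≡ f j → i ≡ j) × (adj H i j ≡ true → adj G (f i) (f j) ≡ true)
    pairOk-sound f i j ok = injective (proj₁ parts) , T-not-∨⇒ (proj₂ parts)
      where
      parts : T (⌊ i ≟ j ⌋ ∨ not ⌊ f i ≟ f j ⌋) × T (not (adj H i j) ∨ adj G (f i) (f j))
      parts = Equivalence.to T-∧ ok
      injective : T (⌊ i ≟ j ⌋ ∨ not ⌊ f i ≟ f j ⌋) → f i ≡ f j → i ≡ j
      injective t fi≡fj with i ≟ j | f i ≟ f j
      ... | yes i≡j | _         = i≡j
      ... | no _    | no fi≢fj  = ⊥-elim (fi≢fj fi≡fj)

    pairOk-complete : ∀ f → IsEmbedding H G f → ∀ i j → T (pairOk f (i , j))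
    pairOk-complete f (inj , edge) i j = Equivalence.from T-∧ (distinct , preserved)
      where
      distinct : T (⌊ i ≟ j ⌋ ∨ not ⌊ f i ≟ f j ⌋)
      distinct with i ≟ j | f i ≟ f j
      ... | yes _   | _         = _
      ... | no _    | no _      = _
      ... | no i≢j  | yes fi≡fj = i≢j (inj fi≡fj)
      preserved : T (not (adj H i j) ∨ adj G (f i) (f j))
      preserved with adj H i j in e
      ... | false = _
      ... | true  = Equivalence.from T-≡ (edge i j e)

  ∈-embeddings⁻ : ∀ {φ} → φ ∈ embeddings H G → IsEmbedding H G (lookup φ)
  ∈-embeddings⁻ {φ} φ∈ = (λ {i} {j} → proj₁ (sound i j)) , (λ i j → proj₂ (sound i j))
    where
    accepted : T (isEmbedding H G φ)
    accepted = proj₂ (∈-filter⁻ (T? ∘ isEmbedding H G) {xs = allVecs (allFin n) h} φ∈)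
    sound : ∀ i j → (lookup φ i ≡ lookup φ j → i ≡ j) × (adj H i j ≡ true → adj G (lookup φ i) (lookup φ j) ≡ true)
    sound i j = pairOk-sound (lookup φ) i j (All.lookup (all⁺ (pairOk (lookup φ)) (pairs h) accepted) (∈-pairs i j))

  ∈-embeddings⁺ : ∀ {φ} → IsEmbedding H G (lookup φ) → φ ∈ embeddings H G
  ∈-embeddings⁺ {φ} emb = ∈-filter⁺ (T? ∘ isEmbedding H G) (∈-allVecs ∈-allFin φ)
    (all⁻ (pairOk (lookup φ)) {pairs h} (All.tabulate (λ { {i , j} _ → pairOk-complete (lookup φ) emb i j })))

module _ {h n : ℕ} where

  vertexImage : Vec (Fin n) h → Fin n → Bool
  vertexImage φ v = any (λ i → ⌊ lookup φ i ≟ v ⌋) (allFin h)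

  edgeImage : Graph h → Vec (Fin n) h → Fin n → Fin n → Bool
  edgeImage H φ u v =
    any (λ p → adj H (proj₁ p) (proj₂ p) ∧ ⌊ lookup φ (proj₁ p) ≟ u ⌋ ∧ ⌊ lookup φ (proj₂ p) ≟ v ⌋) (pairs h)

  image-≡⁺ : ∀ H (φ₁ φ₂ : Vec (Fin n) h) → vertexImage φ₁ ≗ vertexImage φ₂ →
    (∀ u → edgeImage H φ₁ u ≗ edgeImage H φ₂ u) → image H φ₁ ≡ image H φ₂
  image-≡⁺ H φ₁ φ₂ v≗ e≗ = cong₂ _,_ (tabulate-cong v≗) (tabulate-cong (λ u → tabulate-cong (e≗ u)))

  image-≡⁻ : ∀ H (φ₁ φ₂ : Vec (Fin n) h) → image H φ₁ ≡ image H φ₂ →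
    vertexImage φ₁ ≗ vertexImage φ₂ × (∀ u → edgeImage H φ₁ u ≗ edgeImage H φ₂ u)
  image-≡⁻ H φ₁ φ₂ eq = tabulate-injective (cong proj₁ eq) ,
    λ u → tabulate-injective (tabulate-injective (cong proj₂ eq) u)
    where
    tabulate-injective : ∀ {A : Set} {f g : Fin n → A} → tabulate f ≡ tabulate g → f ≗ g
    tabulate-injective {f = f} {g} eq v =
      trans (sym (lookup∘tabulate f v)) (trans (cong (λ xs → lookup xs v) eq) (lookup∘tabulate g v))

  vertexImage⁻ : ∀ φ {v} → vertexImage φ v ≡ true → Σ (Fin h) λ i → lookup φ i ≡ v
  vertexImage⁻ φ {v} hit with find (any⁻ _ (allFin h) (Equivalence.from T-≡ hit))
  ... | i , _ , t = i , toWitness t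

  edgeImage⁻ : ∀ H φ {u v} → edgeImage H φ u v ≡ true →
    Σ (Fin h) λ i → Σ (Fin h) λ j → lookup φ i ≡ u × lookup φ j ≡ v
  edgeImage⁻ H φ {u} {v} hit with find (any⁻ _ (pairs h) (Equivalence.from T-≡ hit))
  ... | (i , j) , _ , t with Equivalence.to (T-∧ {adj H i j}) t
  ...   | _ , t′ with Equivalence.to (T-∧ {⌊ lookup φ i ≟ u ⌋}) t′
  ...     | tu , tv = i , j , toWitness tu , toWitness tv

module Support {h n} (H : Graph h) (G : Graph n) where

  InCopy : Fin n → Set
  InCopy u = Any (λ φ → Any (λ i → lookup φ i ≡ u) (allFin h)) (embeddings H G)

  inCopy? : Decidable InCopy
  inCopy? u = Any.any? (λ φ → Any.any? (λ i → lookup φ i ≟ u) (allFin h)) (embeddings H G)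

  embedding⇒InCopy : ∀ φ → IsEmbedding H G (lookup φ) → ∀ i → InCopy (lookup φ i)
  embedding⇒InCopy φ emb i = lose (∈-embeddings⁺ H G {φ} emb) (lose {P = λ j → lookup φ j ≡ lookup φ i} (∈-allFin i) refl)

  InCopy⇒embedding : ∀ {u} → InCopy u →
    Σ (Vec (Fin n) h) λ φ → IsEmbedding H G (lookup φ) × Σ (Fin h) λ i → lookup φ i ≡ u
  InCopy⇒embedding c with find c
  ... | φ , φ∈ , hit with find hit
  ...   | i , _ , eq = φ , ∈-embeddings⁻ H G φ∈ , i , eq

  module _ {m} (G′ : Graph m) (ψ : Fin n → Fin m)
    (ψ-injective : ∀ {u v} → InCopy u → InCopy v → ψ u ≡ ψ v → u ≡ v)
    (ψ-adj : ∀ {u v} → InCopy u → InCopy v → adj G u v ≡ true → adj G′ (ψ u) (ψ v) ≡ true) where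

    private
      ψ-≟ : ∀ {u v} → InCopy u → InCopy v → ⌊ ψ u ≟ ψ v ⌋ ≡ ⌊ u ≟ v ⌋
      ψ-≟ {u} {v} cu cv with u ≟ v | ψ u ≟ ψ v
      ... | yes _   | yes _ = refl
      ... | no _    | no _  = refl
      ... | yes u≡v | no ψu≢ψv = ⊥-elim (ψu≢ψv (cong ψ u≡v))
      ... | no u≢v  | yes ψu≡ψv = ⊥-elim (u≢v (ψ-injective cu cv ψu≡ψv))

      module _ (φ : Vec (Fin n) h) (emb : IsEmbedding H G (lookup φ)) where

        lookup-ψ-≟ : ∀ i {v} → InCopy v → ⌊ lookup (V.map ψ φ) i ≟ ψ v ⌋ ≡ ⌊ lookup φ i ≟ v ⌋
        lookup-ψ-≟ i cv = trans (cong (λ z → ⌊ z ≟ _ ⌋) (lookup-map i ψ φ)) (ψ-≟ (embedding⇒InCopy φ emb i) cv)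

        map-embedding : IsEmbedding H G′ (lookup (V.map ψ φ))
        map-embedding = injective , preserves
          where
          injective : Injective _≡_ _≡_ (lookup (V.map ψ φ))
          injective {i} {j} eq rewrite lookup-map i ψ φ | lookup-map j ψ φ =
            proj₁ emb (ψ-injective (embedding⇒InCopy φ emb i) (embedding⇒InCopy φ emb j) eq)
          preserves : ∀ i j → adj H i j ≡ true → adj G′ (lookup (V.map ψ φ) i) (lookup (V.map ψ φ) j) ≡ true
          preserves i j e rewrite lookup-map i ψ φ | lookup-map j ψ φ =
            ψ-adj (embedding⇒InCopy φ emb i) (embedding⇒InCopy φ emb j) (proj₂ emb i j e)

        vertexImage-map : ∀ {v} → InCopy v → vertexImage (V.map ψ φ) (ψ v) ≡ vertexImage φ v
        vertexImage-map cv = cong or (map-cong (λ i → lookup-ψ-≟ i cv) (allFin h))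

        edgeImage-map : ∀ {u v} → InCopy u → InCopy v → edgeImage H (V.map ψ φ) (ψ u) (ψ v) ≡ edgeImage H φ u v
        edgeImage-map cu cv = cong or (map-cong
          (λ p → cong₂ (λ a b → adj H (proj₁ p) (proj₂ p) ∧ a ∧ b)
                       (lookup-ψ-≟ (proj₁ p) cu) (lookup-ψ-≟ (proj₂ p) cv))
          (pairs h))

        vertexImage-support : ∀ {v} → vertexImage φ v ≡ true → InCopy v
        vertexImage-support hit with vertexImage⁻ φ hit
        ... | i , refl = embedding⇒InCopy φ emb i

        edgeImage-support : ∀ {u v} → edgeImage H φ u v ≡ true → InCopy u × InCopy v
        edgeImage-support hit with edgeImage⁻ H φ hit
        ... | i , j , refl , refl = embedding⇒InCopy φ emb i , embedding⇒InCopy φ emb j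

      -- The image bits of φ₁ and φ₂ can only differ where one of them is true, i.e. on the
      -- support, where ψ is injective.
      image-map-injective : ∀ φ₁ φ₂ → IsEmbedding H G (lookup φ₁) → IsEmbedding H G (lookup φ₂) →
        image H (V.map ψ φ₁) ≡ image H (V.map ψ φ₂) → image H φ₁ ≡ image H φ₂
      image-map-injective φ₁ φ₂ emb₁ emb₂ eq = image-≡⁺ H φ₁ φ₂
        (λ v → Bool-≡-via (vertexImage-support φ₁ emb₁) (vertexImage-support φ₂ emb₂) (λ cv → begin
          vertexImage φ₁ v              ≡⟨ vertexImage-map φ₁ emb₁ cv ⟨
          vertexImage (V.map ψ φ₁) (ψ v) ≡⟨ proj₁ mapped-images (ψ v) ⟩
          vertexImage (V.map ψ φ₂) (ψ v) ≡⟨ vertexImage-map φ₂ emb₂ cv ⟩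
          vertexImage φ₂ v              ∎))
        (λ u v → Bool-≡-via (edgeImage-support φ₁ emb₁) (edgeImage-support φ₂ emb₂) (λ (cu , cv) → begin
          edgeImage H φ₁ u v                    ≡⟨ edgeImage-map φ₁ emb₁ cu cv ⟨
          edgeImage H (V.map ψ φ₁) (ψ u) (ψ v) ≡⟨ proj₂ mapped-images (ψ u) (ψ v) ⟩
          edgeImage H (V.map ψ φ₂) (ψ u) (ψ v) ≡⟨ edgeImage-map φ₂ emb₂ cu cv ⟩
          edgeImage H φ₂ u v                    ∎))
        where
        open ≡-Reasoning
        mapped-images : vertexImage (V.map ψ φ₁) ≗ vertexImage (V.map ψ φ₂)
                      × (∀ u → edgeImage H (V.map ψ φ₁) u ≗ edgeImage H (V.map ψ φ₂) u)
        mapped-images = image-≡⁻ H (V.map ψ φ₁) (V.map ψ φ₂) eq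

    numCopies-mono : numCopies H G ≤ numCopies H G′
    numCopies-mono = length-deduplicate-map-≤ _≟Img_ _≟Img_ (image H) (image H) (V.map ψ)
      (λ {φ} φ∈ → ∈-embeddings⁺ H G′ {V.map ψ φ} (map-embedding φ (∈-embeddings⁻ H G φ∈)))
      (λ {φ₁} {φ₂} φ₁∈ φ₂∈ →
        image-map-injective φ₁ φ₂ (∈-embeddings⁻ H G φ₁∈) (∈-embeddings⁻ H G φ₂∈))

fromRel-adj⁺ : ∀ {n} (r : Fin n → Fin n → Bool) {i j} → r i j ≡ true ⊎ r j i ≡ true → i ≢ j →
  adj (fromRel r) i j ≡ true
fromRel-adj⁺ r {i} {j} rel i≢j with i ≟ j | r i j | r j i | rel
... | yes i≡j | _     | _     | _      = ⊥-elim (i≢j i≡j)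
... | no _    | true  | _     | _      = refl
... | no _    | false | true  | _      = refl
... | no _    | false | false | inj₁ ()
... | no _    | false | false | inj₂ ()

fromRel-adj⁻ : ∀ {n} (r : Fin n → Fin n → Bool) {i j} → adj (fromRel r) i j ≡ true →
  (r i j ≡ true ⊎ r j i ≡ true) × i ≢ j
fromRel-adj⁻ r {i} {j} e with r i j | r j i | i ≟ j
... | true  | _     | no i≢j = inj₁ refl , i≢j
... | false | true  | no i≢j = inj₂ refl , i≢j

K-adj⁺ : ∀ {m} {i j : Fin m} → i ≢ j → adj (K m) i j ≡ true
K-adj⁺ = fromRel-adj⁺ (λ _ _ → true) (inj₁ refl)

K-adj⁻ : ∀ {m} {i j : Fin m} → adj (K m) i j ≡ true → i ≢ j
K-adj⁻ = proj₂ ∘ fromRel-adj⁻ (λ _ _ → true)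

bothBelow : ∀ {n} → ℕ → Fin n → Fin n → Bool
bothBelow m i j = (toℕ i <ᵇ m) ∧ (toℕ j <ᵇ m)

paddedClique : (n m : ℕ) → Graph n
paddedClique n m = fromRel (bothBelow m)

paddedClique-adj⁺ : ∀ {n m} {i j : Fin n} → toℕ i < m → toℕ j < m → i ≢ j → adj (paddedClique n m) i j ≡ true
paddedClique-adj⁺ {m = m} i<m j<m = fromRel-adj⁺ (bothBelow m) (inj₁ (cong₂ _∧_ (<ᵇ-true i<m) (<ᵇ-true j<m)))

paddedClique-adj⁻ : ∀ {n m} {i j : Fin n} → adj (paddedClique n m) i j ≡ true → toℕ i < m
paddedClique-adj⁻ {m = m} {i} e = <ᵇ⇒< (toℕ i) m (first-conjunct (proj₁ (fromRel-adj⁻ (bothBelow m) e)))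
  where
  first-conjunct : ∀ {a b} → a ∧ b ≡ true ⊎ b ∧ a ≡ true → T a
  first-conjunct         (inj₁ ab) = proj₁ (Equivalence.to T-∧ (Equivalence.from T-≡ ab))
  first-conjunct {b = b} (inj₂ ba) = proj₂ (Equivalence.to (T-∧ {b}) (Equivalence.from T-≡ ba))

shiftedBy : ∀ s → Fin (s + s) → Fin (s + s) → Bool
shiftedBy s i j = (toℕ i + s) ≡ᵇ toℕ j

↑ˡ≢↑ʳ : ∀ s (a b : Fin s) → a ↑ˡ s ≢ s ↑ʳ b
↑ˡ≢↑ʳ s a b eq = <⇒≱ (toℕ<n a) (begin
  s                ≤⟨ m≤m+n s (toℕ b) ⟩
  s + toℕ b        ≡⟨ toℕ-↑ʳ s b ⟨
  toℕ (s ↑ʳ b)     ≡⟨ cong toℕ eq ⟨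
  toℕ (a ↑ˡ s)     ≡⟨ toℕ-↑ˡ a s ⟩
  toℕ a            ∎)
  where open ≤-Reasoning

M-edge : ∀ s (a : Fin s) → adj (M s) (a ↑ˡ s) (s ↑ʳ a) ≡ true
M-edge s a = fromRel-adj⁺ (shiftedBy s) (inj₁ (Equivalence.to T-≡ (≡⇒≡ᵇ _ _ shift))) (↑ˡ≢↑ʳ s a a)
  where
  open ≡-Reasoning
  shift : toℕ (a ↑ˡ s) + s ≡ toℕ (s ↑ʳ a)
  shift = begin
    toℕ (a ↑ˡ s) + s ≡⟨ cong (_+ s) (toℕ-↑ˡ a s) ⟩
    toℕ a + s        ≡⟨ +-comm (toℕ a) s ⟩
    s + toℕ a        ≡⟨ toℕ-↑ʳ s a ⟨
    toℕ (s ↑ʳ a)     ∎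

shifted-pair : ∀ s (i j : Fin (s + s)) → toℕ i + s ≡ toℕ j → Σ (Fin s) λ a → i ≡ a ↑ˡ s × j ≡ s ↑ʳ a
shifted-pair s i j shift = a , toℕ-injective i-index , toℕ-injective j-index
  where
  open ≡-Reasoning
  i<s : toℕ i < s
  i<s = +-cancelʳ-< s (toℕ i) s (subst (_< s + s) (sym shift) (toℕ<n j))
  a : Fin s
  a = fromℕ< i<s
  i-index : toℕ i ≡ toℕ (a ↑ˡ s)
  i-index = sym (trans (toℕ-↑ˡ a s) (toℕ-fromℕ< i<s))
  j-index : toℕ j ≡ toℕ (s ↑ʳ a)
  j-index = begin
    toℕ j         ≡⟨ shift ⟨
    toℕ i + s     ≡⟨ +-comm (toℕ i) s ⟩
    s + toℕ i     ≡⟨ cong (s +_) (toℕ-fromℕ< i<s) ⟨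
    s + toℕ a     ≡⟨ toℕ-↑ʳ s a ⟨
    toℕ (s ↑ʳ a)  ∎

M-edge⁻ : ∀ s {i j} → adj (M s) i j ≡ true →
  Σ (Fin s) λ a → (i ≡ a ↑ˡ s × j ≡ s ↑ʳ a) ⊎ (j ≡ a ↑ˡ s × i ≡ s ↑ʳ a)
M-edge⁻ s {i} {j} e with proj₁ (fromRel-adj⁻ (shiftedBy s) {i} {j} e)
... | inj₁ rij = let a , eqs = shifted-pair s i j (≡ᵇ⇒≡ (toℕ i + s) (toℕ j) (Equivalence.from T-≡ rij)) in a , inj₁ eqs
... | inj₂ rji = let a , eqs = shifted-pair s j i (≡ᵇ⇒≡ (toℕ j + s) (toℕ i) (Equivalence.from T-≡ rji)) in a , inj₂ eqs

M-neighbour : ∀ s (i : Fin (s + s)) → Σ (Fin (s + s)) λ j → adj (M s) i j ≡ true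
M-neighbour s i with splitAt s i in split
... | inj₁ a = s ↑ʳ a , subst (λ v → adj (M s) v (s ↑ʳ a) ≡ true) (splitAt⁻¹-↑ˡ split) (M-edge s a)
... | inj₂ a = a ↑ˡ s , subst (λ v → adj (M s) v (a ↑ˡ s) ≡ true) (splitAt⁻¹-↑ʳ split)
                          (trans (Graph.sym (M s) (s ↑ʳ a) (a ↑ˡ s)) (M-edge s a))

bounded-injection⇒≤ : ∀ {k n m} (f : Fin k → Fin n) → Injective _≡_ _≡_ f → (∀ i → toℕ (f i) < m) → k ≤ m
bounded-injection⇒≤ f f-injective below = injective⇒≤ {f = λ i → fromℕ< (below i)} (λ {i} {j} eq →
  f-injective (toℕ-injective (begin
    toℕ (f i)                ≡⟨ toℕ-fromℕ< (below i) ⟨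
    toℕ (fromℕ< (below i))   ≡⟨ cong toℕ eq ⟩
    toℕ (fromℕ< (below j))   ≡⟨ toℕ-fromℕ< (below j) ⟩
    toℕ (f j)                ∎)))
  where open ≡-Reasoning

M-free-if-edges-below : ∀ {n} s m (G : Graph n) → (∀ {u v} → adj G u v ≡ true → toℕ u < m) → m < s + s →
  ¬ Contains (M s) G
M-free-if-edges-below s m G below m<2s (φ , φ-injective , preserves) =
  <⇒≱ m<2s (bounded-injection⇒≤ φ φ-injective (λ i → below (preserves i _ (proj₂ (M-neighbour s i)))))

M-free-if-covered : ∀ {n} s t (G : Graph n) → (∀ {u v} → adj G u v ≡ true → toℕ u < t ⊎ toℕ v < t) → t < s →
  ¬ Contains (M s) G
M-free-if-covered s t G covered t<s (φ , φ-injective , preserves) =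
  <⇒≱ t<s (bounded-injection⇒≤ (φ ∘ coveringEnd) (λ eq → coveringEnd-injective (φ-injective eq))
                                 (λ a → proj₂ (proj₂ (covering a))))
  where
  covering : ∀ a → Σ (Fin (s + s)) λ v → [ id , id ] (splitAt s v) ≡ a × toℕ (φ v) < t
  covering a with covered (preserves _ _ (M-edge s a))
  ... | inj₁ left<t  = a ↑ˡ s , cong [ id , id ] (splitAt-↑ˡ s a s) , left<t
  ... | inj₂ right<t = s ↑ʳ a , cong [ id , id ] (splitAt-↑ʳ s s a) , right<t
  coveringEnd : Fin s → Fin (s + s)
  coveringEnd a = proj₁ (covering a)
  coveringEnd-injective : Injective _≡_ _≡_ coveringEnd
  coveringEnd-injective {a} {b} eq =
    trans (sym (proj₁ (proj₂ (covering a)))) (trans (cong ([ id , id ] ∘ splitAt s) eq) (proj₁ (proj₂ (covering b))))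

-- In Hnka n k a the vertices [0, a) form A, [a, end) form B and the rest form C, so
-- n ≤ end + 1 says that |C| ≤ 1, and then every edge meets A.
module _ (n k a : ℕ) where

  private
    end : ℕ
    end = a + ((n ∸ k) + a)

    InB : Fin n → Bool
    InB v = (a ≤ᵇ toℕ v) ∧ (toℕ v <ᵇ end)

    rel : Fin n → Fin n → Bool
    rel i j = ((toℕ i <ᵇ a) ∧ InB j) ∨ (not (InB i) ∧ not (InB j))

    A-universal : ∀ {inAi a≤i i<end inBj} → inAi ≡ true → a≤i ≡ false →
      (inAi ∧ inBj) ∨ (not (a≤i ∧ i<end) ∧ not inBj) ≡ true
    A-universal {inBj = true}  refl refl = refl
    A-universal {inBj = false} refl refl = refl

    outside-A-not-in-B : ∀ {inAi inBi inBj} → inAi ≡ false →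
      (inAi ∧ inBj) ∨ (not inBi ∧ not inBj) ≡ true → inBi ≡ false × inBj ≡ false
    outside-A-not-in-B {false} {false} {false} refl _ = refl , refl

    outside-A∪B-is-end : n ≤ suc end → ∀ v → ¬ toℕ v < a → InB v ≡ false → toℕ v ≡ end
    outside-A∪B-is-end n≤ v v≮a v∉B = ≤-antisym (s≤s⁻¹ (≤-trans (toℕ<n v) n≤)) (≮⇒≥ v≮end)
      where
      v≮end : ¬ toℕ v < end
      v≮end v<end = false≢true (trans (sym v∉B) (cong₂ _∧_ (≤ᵇ-true (≮⇒≥ v≮a)) (<ᵇ-true v<end)))

  Hnka-adj⁺ : ∀ {i j : Fin n} → toℕ i < a → i ≢ j → adj (Hnka n k a) i j ≡ true
  Hnka-adj⁺ i<a = fromRel-adj⁺ rel (inj₁ (A-universal (<ᵇ-true i<a) (≤ᵇ-false (<⇒≱ i<a))))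

  Hnka-cover : n ≤ suc end → ∀ {i j} → adj (Hnka n k a) i j ≡ true → toℕ i < a ⊎ toℕ j < a
  Hnka-cover n≤ {i} {j} e with toℕ i <? a | toℕ j <? a | fromRel-adj⁻ rel e
  ... | yes i<a | _       | _ = inj₁ i<a
  ... | no _    | yes j<a | _ = inj₂ j<a
  ... | no i≮a  | no j≮a  | inj₁ rij , i≢j =
    let i∉B , j∉B = outside-A-not-in-B (<ᵇ-false i≮a) rij
    in ⊥-elim (i≢j (toℕ-injective (trans (outside-A∪B-is-end n≤ i i≮a i∉B) (sym (outside-A∪B-is-end n≤ j j≮a j∉B)))))
  ... | no i≮a  | no j≮a  | inj₂ rji , i≢j =
    let j∉B , i∉B = outside-A-not-in-B (<ᵇ-false j≮a) rji
    in ⊥-elim (i≢j (toℕ-injective (trans (outside-A∪B-is-end n≤ i i≮a i∉B) (sym (outside-A∪B-is-end n≤ j j≮a j∉B)))))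

numCopies-K≤paddedClique : ∀ {h} (H : Graph h) {m n} → m ≤ n → numCopies H (K m) ≤ numCopies H (paddedClique n m)
numCopies-K≤paddedClique H {m} {n} m≤n = Support.numCopies-mono H (K m) (paddedClique n m) ι
  (λ _ _ → ι-injective) (λ {u} {v} _ _ e → paddedClique-adj⁺ (ι<m u) (ι<m v) (K-adj⁻ e ∘ ι-injective))
  where
  ι : Fin m → Fin n
  ι i = inject≤ i m≤n
  ι-injective : Injective _≡_ _≡_ ι
  ι-injective = inject≤-injective m≤n m≤n _ _
  ι<m : ∀ i → toℕ (ι i) < m
  ι<m i = subst (_< m) (sym (toℕ-inject≤ i m≤n)) (toℕ<n i)

module Position {n m} (L : List (Fin n)) (L≤m : length L ≤ m) (0<m : 0 < m) where

  open import Data.List.Membership.DecPropositional (_≟_ {n}) using (_∈?_)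

  position : Fin n → Fin m
  position v with v ∈? L
  ... | yes v∈L = inject≤ (index v∈L) L≤m
  ... | no  _   = fromℕ< 0<m

  position-injective : ∀ {u v} → u ∈ L → v ∈ L → position u ≡ position v → u ≡ v
  position-injective {u} {v} u∈L v∈L eq with u ∈? L | v ∈? L
  ... | yes p | yes q =
    trans (lookup-index p) (trans (cong (List.lookup L) (inject≤-injective L≤m L≤m _ _ eq)) (sym (lookup-index q)))
  ... | no u∉L | _    = ⊥-elim (u∉L u∈L)
  ... | yes _ | no v∉L = ⊥-elim (v∉L v∈L)

  position-prefix : ∀ xs {ys} → L ≡ xs ++ ys → ∀ {v} → v ∈ xs → v ∉ ys → toℕ (position v) < length xs
  position-prefix xs refl {v} v∈xs v∉ys with v ∈? L
  ... | yes v∈L = subst (_< length xs) (sym (toℕ-inject≤ (index v∈L) L≤m)) (index-++ˡ xs v∈L v∉ys)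
  ... | no  v∉L = ⊥-elim (v∉L (∈-++⁺ˡ v∈xs))

module Matchings {n} (G : Graph n) (P : Fin n → Set) (P? : Decidable P) where

  infix 4 _~_ _~?_

  _~_ : Fin n → Fin n → Set
  u ~ v = adj G u v ≡ true

  _~?_ : ∀ u v → Dec (u ~ v)
  u ~? v = adj G u v Bool.≟ true

  ~-sym : ∀ {u v} → u ~ v → v ~ u
  ~-sym {u} {v} u~v = trans (Graph.sym G v u) u~v

  ~-irrefl : ∀ {u v} → u ~ v → u ≢ v
  ~-irrefl {u} u~u refl with trans (sym u~u) (irrefl G u)
  ... | ()

  neighbours : Fin n → List (Fin n)
  neighbours u = filter (λ v → P? v ×-dec u ~? v) (allFin n)

  degree : Fin n → ℕ
  degree u = length (neighbours u)

  neighbours-unique : ∀ u → Unique (neighbours u)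
  neighbours-unique u = Unique.filter⁺ _ (Unique.allFin⁺ n)

  ∈-neighbours⁺ : ∀ {u v} → P v → u ~ v → v ∈ neighbours u
  ∈-neighbours⁺ Pv u~v = ∈-filter⁺ _ (∈-allFin _) (Pv , u~v)

  ∈-neighbours⁻ : ∀ {u v} → v ∈ neighbours u → P v × u ~ v
  ∈-neighbours⁻ {u} v∈ = proj₂ (∈-filter⁻ (λ v → P? v ×-dec u ~? v) {xs = allFin n} v∈)

  vertices : List (Fin n)
  vertices = filter P? (allFin n)

  record Matching (k : ℕ) : Set where
    field
      x y         : Fin k → Fin n
      edge        : ∀ i → x i ~ y i
      Px          : ∀ i → P (x i)
      Py          : ∀ i → P (y i)
      x-injective : Injective _≡_ _≡_ x
      y-injective : Injective _≡_ _≡_ y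
      x≢y         : ∀ i j → x i ≢ y j

  open Matching public

  Unmatched : ∀ {k} → Matching k → Fin n → Set
  Unmatched M v = ∀ i → x M i ≢ v × y M i ≢ v

  unmatched? : ∀ {k} (M : Matching k) → Decidable (Unmatched M)
  unmatched? M v = all? (λ i → ¬? (x M i ≟ v) ×-dec ¬? (y M i ≟ v))

  matched-or-unmatched : ∀ {k} (M : Matching k) v →
    Unmatched M v ⊎ Σ (Fin k) λ i → x M i ≡ v ⊎ y M i ≡ v
  matched-or-unmatched M v with any? (λ i → (x M i ≟ v) ⊎-dec (y M i ≟ v))
  ... | yes (i , hit) = inj₂ (i , hit)
  ... | no  none      = inj₁ (λ i → (λ eq → none (i , inj₁ eq)) , (λ eq → none (i , inj₂ eq)))

  empty : Matching 0
  empty = record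
    { x = λ () ; y = λ () ; edge = λ () ; Px = λ () ; Py = λ ()
    ; x-injective = λ { {()} } ; y-injective = λ { {()} } ; x≢y = λ () }

  extend : ∀ {k} (M : Matching k) {p q} → Unmatched M p → Unmatched M q → p ~ q → P p → P q → Matching (suc k)
  extend {k} M {p} {q} p-free q-free p~q Pp Pq = record
    { x = x′ ; y = y′ ; edge = edge′ ; Px = Px′ ; Py = Py′
    ; x-injective = x′-injective ; y-injective = y′-injective ; x≢y = x′≢y′ }
    where
    x′ y′ : Fin (suc k) → Fin n
    x′ zero    = p
    x′ (suc i) = x M i
    y′ zero    = q
    y′ (suc i) = y M i
    edge′ : ∀ i → x′ i ~ y′ i
    edge′ zero    = p~q
    edge′ (suc i) = edge M i
    Px′ : ∀ i → P (x′ i)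
    Px′ zero    = Pp
    Px′ (suc i) = Px M i
    Py′ : ∀ i → P (y′ i)
    Py′ zero    = Pq
    Py′ (suc i) = Py M i
    x′-injective : Injective _≡_ _≡_ x′
    x′-injective {zero}  {zero}  _  = refl
    x′-injective {zero}  {suc j} eq = ⊥-elim (proj₁ (p-free j) (sym eq))
    x′-injective {suc i} {zero}  eq = ⊥-elim (proj₁ (p-free i) eq)
    x′-injective {suc i} {suc j} eq = cong suc (x-injective M eq)
    y′-injective : Injective _≡_ _≡_ y′
    y′-injective {zero}  {zero}  _  = refl
    y′-injective {zero}  {suc j} eq = ⊥-elim (proj₂ (q-free j) (sym eq))
    y′-injective {suc i} {zero}  eq = ⊥-elim (proj₂ (q-free i) eq)
    y′-injective {suc i} {suc j} eq = cong suc (y-injective M eq)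
    x′≢y′ : ∀ i j → x′ i ≢ y′ j
    x′≢y′ zero    zero    = ~-irrefl p~q
    x′≢y′ zero    (suc j) = proj₂ (p-free j) ∘ sym
    x′≢y′ (suc i) zero    = proj₁ (q-free i)
    x′≢y′ (suc i) (suc j) = x≢y M i j

  module Rematch {k} (M : Matching k) (i : Fin k) {q} (q-free : Unmatched M q) (xi~q : x M i ~ q) (Pq : P q) where

    private
      y′ : Fin k → Fin n
      y′ = updateAt (y M) i (const q)

      y′-cases : ∀ j → (j ≡ i × y′ j ≡ q) ⊎ (j ≢ i × y′ j ≡ y M j)
      y′-cases j with j ≟ i
      ... | yes refl = inj₁ (refl , updateAt-updates i (y M))
      ... | no  j≢i  = inj₂ (j≢i , updateAt-minimal j i (y M) j≢i)

      edge′ : ∀ j → x M j ~ y′ j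
      edge′ j with y′-cases j
      ... | inj₁ (refl , eq) = subst (x M i ~_) (sym eq) xi~q
      ... | inj₂ (_    , eq) = subst (x M j ~_) (sym eq) (edge M j)

      Py′ : ∀ j → P (y′ j)
      Py′ j with y′-cases j
      ... | inj₁ (_ , eq) = subst P (sym eq) Pq
      ... | inj₂ (_ , eq) = subst P (sym eq) (Py M j)

      y′-injective : Injective _≡_ _≡_ y′
      y′-injective {j} {l} eq with y′-cases j | y′-cases l
      ... | inj₁ (refl , _)   | inj₁ (refl , _)   = refl
      ... | inj₁ (_ , ej)     | inj₂ (_ , el)     = ⊥-elim (proj₂ (q-free l) (sym (trans (sym ej) (trans eq el))))
      ... | inj₂ (_ , ej)     | inj₁ (_ , el)     = ⊥-elim (proj₂ (q-free j) (trans (sym ej) (trans eq el)))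
      ... | inj₂ (_ , ej)     | inj₂ (_ , el)     = y-injective M (trans (sym ej) (trans eq el))

      x≢y′ : ∀ j l → x M j ≢ y′ l
      x≢y′ j l eq with y′-cases l
      ... | inj₁ (_ , el) = proj₁ (q-free j) (trans eq el)
      ... | inj₂ (_ , el) = x≢y M j l (trans eq el)

    matching : Matching k
    matching = record
      { x = x M ; y = y′ ; edge = edge′ ; Px = Px M ; Py = Py′
      ; x-injective = x-injective M ; y-injective = y′-injective ; x≢y = x≢y′ }

    y-unchanged : ∀ {j} → j ≢ i → y matching j ≡ y M j
    y-unchanged {j} j≢i = updateAt-minimal j i (y M) j≢i

    frees : Unmatched matching (y M i)
    frees j = (λ eq → x≢y M j i eq) , freed
      where
      freed : y′ j ≢ y M i
      freed eq with y′-cases j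
      ... | inj₁ (refl , ej) = proj₂ (q-free i) (sym (trans (sym ej) eq))
      ... | inj₂ (j≢i , ej)  = j≢i (y-injective M (trans (sym ej) eq))

    keeps : ∀ {v} → Unmatched M v → q ≢ v → Unmatched matching v
    keeps {v} v-free q≢v j = proj₁ (v-free j) , kept
      where
      kept : y′ j ≢ v
      kept eq with y′-cases j
      ... | inj₁ (_ , ej) = q≢v (trans (sym ej) eq)
      ... | inj₂ (_ , ej) = proj₂ (v-free j) (trans (sym ej) eq)

  -- Augmentation along the path p – y i – x i – q.
  cross : ∀ {k} (M : Matching k) i {p q} → Unmatched M p → Unmatched M q → p ≢ q →
    x M i ~ q → p ~ y M i → P p → P q → Matching (suc k)
  cross M i p-free q-free p≢q xi~q p~yi Pp Pq =
    extend N (keeps p-free (p≢q ∘ sym)) frees p~yi Pp (Py M i)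
    where
    open Rematch M i q-free xi~q Pq renaming (matching to N)

  reorient : ∀ {k} → Matching k → (Fin k → Bool) → Matching k
  reorient {k} M flip = record
    { x = x′ ; y = y′ ; edge = edge′ ; Px = Px′ ; Py = Py′
    ; x-injective = x′-injective ; y-injective = y′-injective ; x≢y = x′≢y′ }
    where
    x′ y′ : Fin k → Fin n
    x′ i = if flip i then y M i else x M i
    y′ i = if flip i then x M i else y M i
    edge′ : ∀ i → x′ i ~ y′ i
    edge′ i with flip i
    ... | true  = ~-sym (edge M i)
    ... | false = edge M i
    Px′ : ∀ i → P (x′ i)
    Px′ i with flip i
    ... | true  = Py M i
    ... | false = Px M i
    Py′ : ∀ i → P (y′ i)
    Py′ i with flip i
    ... | true  = Px M i
    ... | false = Py M i
    flips-agree : ∀ {i j} → i ≡ j → flip i ≡ true → flip j ≡ false → ⊥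
    flips-agree refl fi fj with trans (sym fi) fj
    ... | ()
    x′-injective : Injective _≡_ _≡_ x′
    x′-injective {i} {j} eq with flip i in fi | flip j in fj
    ... | true  | true  = y-injective M eq
    ... | false | false = x-injective M eq
    ... | true  | false = ⊥-elim (x≢y M j i (sym eq))
    ... | false | true  = ⊥-elim (x≢y M i j eq)
    y′-injective : Injective _≡_ _≡_ y′
    y′-injective {i} {j} eq with flip i in fi | flip j in fj
    ... | true  | true  = x-injective M eq
    ... | false | false = y-injective M eq
    ... | true  | false = ⊥-elim (x≢y M i j eq)
    ... | false | true  = ⊥-elim (x≢y M j i (sym eq))
    x′≢y′ : ∀ i j → x′ i ≢ y′ j
    x′≢y′ i j eq with flip i in fi | flip j in fj
    ... | true  | true  = x≢y M j i (sym eq)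
    ... | false | false = x≢y M i j eq
    ... | true  | false = flips-agree (y-injective M eq) fi fj
    ... | false | true  = flips-agree (sym (x-injective M eq)) fj fi

  reorient-unmatched : ∀ {k} (M : Matching k) flip {v} → Unmatched M v → Unmatched (reorient M flip) v
  reorient-unmatched M flip v-free i with flip i
  ... | true  = proj₂ (v-free i) , proj₁ (v-free i)
  ... | false = v-free i

  module _ {k} (M : Matching k) (u : Fin n) where

    xHits yHits : List (Fin k)
    xHits = filter (λ i → u ~? x M i) (allFin k)
    yHits = filter (λ i → u ~? y M i) (allFin k)

    degree≤hits : (∀ {z} → P z → u ~ z → ¬ Unmatched M z) → degree u ≤ length xHits + length yHits
    degree≤hits saturated = begin
      degree u                                          ≤⟨ Unique⇒length≤ (neighbours-unique u) neighbours⊆ ⟩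
      length (map (x M) xHits ++ map (y M) yHits)       ≡⟨ length-++ (map (x M) xHits) ⟩
      length (map (x M) xHits) + length (map (y M) yHits) ≡⟨ cong₂ _+_ (length-map (x M) xHits) (length-map (y M) yHits) ⟩
      length xHits + length yHits                       ∎
      where
      open ≤-Reasoning
      neighbours⊆ : neighbours u ⊆ map (x M) xHits ++ map (y M) yHits
      neighbours⊆ z∈ with ∈-neighbours⁻ z∈
      ... | Pz , u~z with matched-or-unmatched M _
      ...   | inj₁ z-free             = ⊥-elim (saturated Pz u~z z-free)
      ...   | inj₂ (i , inj₁ refl) = ∈-++⁺ˡ (∈-map⁺ (x M) (∈-filter⁺ (λ i → u ~? x M i) (∈-allFin i) u~z))
      ...   | inj₂ (i , inj₂ refl) = ∈-++⁺ʳ _ (∈-map⁺ (y M) (∈-filter⁺ (λ i → u ~? y M i) (∈-allFin i) u~z))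

  augment : ∀ {k} (M : Matching k) {u w} → Unmatched M u → Unmatched M w → u ≢ w → P u → P w →
    k + k < degree u + degree w → Matching (suc k)
  augment {k} M {u} {w} u-free w-free u≢w Pu Pw many
    with any? (λ z → P? z ×-dec u ~? z ×-dec unmatched? M z)
  ... | yes (z , Pz , u~z , z-free) = extend M u-free z-free u~z Pu Pz
  ... | no u-saturated with any? (λ z → P? z ×-dec w ~? z ×-dec unmatched? M z)
  ... | yes (z , Pz , w~z , z-free) = extend M w-free z-free w~z Pw Pz
  ... | no w-saturated with any? (λ i → (u ~? x M i ×-dec w ~? y M i) ⊎-dec (u ~? y M i ×-dec w ~? x M i))
  ... | yes (i , inj₁ (u~xi , w~yi)) = cross M i w-free u-free (u≢w ∘ sym) (~-sym u~xi) w~yi Pw Pu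
  ... | yes (i , inj₂ (u~yi , w~xi)) = cross M i u-free w-free u≢w (~-sym w~xi) u~yi Pu Pw
  -- Without an augmenting path through u and w, every edge x i y i receives at most two
  -- of the edges leaving u and w.
  ... | no no-cross = ⊥-elim (<⇒≱ many (begin
    degree u + degree w
      ≤⟨ +-mono-≤ (degree≤hits M u (λ Pz u~z z-free → u-saturated (_ , Pz , u~z , z-free)))
                  (degree≤hits M w (λ Pz w~z z-free → w-saturated (_ , Pz , w~z , z-free))) ⟩
    (length (xHits M u) + length (yHits M u)) + (length (xHits M w) + length (yHits M w))
      ≡⟨ cong ((length (xHits M u) + length (yHits M u)) +_) (+-comm (length (xHits M w)) _) ⟩
    (length (xHits M u) + length (yHits M u)) + (length (yHits M w) + length (xHits M w))
      ≡⟨ interchange (length (xHits M u)) _ _ _ ⟩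
    (length (xHits M u) + length (yHits M w)) + (length (yHits M u) + length (xHits M w))
      ≤⟨ +-mono-≤ (length-filter-disjoint≤ (λ i → u ~? x M i) (λ i → w ~? y M i)
                                            (λ {i} u~xi w~yi → no-cross (i , inj₁ (u~xi , w~yi))))
                  (length-filter-disjoint≤ (λ i → u ~? y M i) (λ i → w ~? x M i)
                                            (λ {i} u~yi w~xi → no-cross (i , inj₂ (u~yi , w~xi)))) ⟩
    k + k ∎))
    where open ≤-Reasoning

  unmatchedVertices : ∀ {k} → Matching k → List (Fin n)
  unmatchedVertices M = filter (λ v → P? v ×-dec unmatched? M v) (allFin n)

  length-vertices≤ : ∀ {k} (M : Matching k) → length vertices ≤ length (unmatchedVertices M) + (k + k)
  length-vertices≤ {k} M = begin
    length vertices                                  ≤⟨ Unique⇒length≤ (Unique.filter⁺ P? (Unique.allFin⁺ n)) vertices⊆ ⟩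
    length (unmatchedVertices M ++ (List.tabulate (x M) ++ List.tabulate (y M)))
      ≡⟨ length-++ (unmatchedVertices M) ⟩
    length (unmatchedVertices M) + length (List.tabulate (x M) ++ List.tabulate (y M))
      ≡⟨ cong (length (unmatchedVertices M) +_) (trans (length-++ (List.tabulate (x M)))
                (cong₂ _+_ (length-tabulate (x M)) (length-tabulate (y M)))) ⟩
    length (unmatchedVertices M) + (k + k) ∎
    where
    open ≤-Reasoning
    vertices⊆ : vertices ⊆ unmatchedVertices M ++ (List.tabulate (x M) ++ List.tabulate (y M))
    vertices⊆ {v} v∈ with matched-or-unmatched M v
    ... | inj₁ v-free = ∈-++⁺ˡ (∈-filter⁺ (λ v → P? v ×-dec unmatched? M v) (∈-allFin v)
                                  (proj₂ (∈-filter⁻ P? {xs = allFin n} v∈) , v-free))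
    ... | inj₂ (i , inj₁ refl) = ∈-++⁺ʳ (unmatchedVertices M) (∈-++⁺ˡ (∈-tabulate⁺ i))
    ... | inj₂ (i , inj₂ refl) = ∈-++⁺ʳ (unmatchedVertices M) (∈-++⁺ʳ (List.tabulate (x M)) (∈-tabulate⁺ i))

  two-unmatched : ∀ {k} (M : Matching k) → suc (suc (k + k)) ≤ length vertices →
    Σ (Fin n) λ a → Σ (Fin n) λ b → a ≢ b × (P a × Unmatched M a) × (P b × Unmatched M b)
  two-unmatched {k} M enough with two-distinct (Unique.filter⁺ unmatched∈P? (Unique.allFin⁺ n)) two≤
    where
    unmatched∈P? : Decidable (λ v → P v × Unmatched M v)
    unmatched∈P? v = P? v ×-dec unmatched? M v
    two≤ : 2 ≤ length (unmatchedVertices M)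
    two≤ = +-cancelʳ-≤ (k + k) 2 _ (≤-trans enough (length-vertices≤ M))
  ... | a , b , a≢b , a∈ , b∈ =
    a , b , a≢b , proj₂ (∈-filter⁻ _ {xs = allFin n} a∈) , proj₂ (∈-filter⁻ _ {xs = allFin n} b∈)

  another-unmatched : ∀ {k} (M : Matching k) → suc (suc (k + k)) ≤ length vertices → ∀ u →
    Σ (Fin n) λ w → w ≢ u × P w × Unmatched M w
  another-unmatched M enough u with two-unmatched M enough
  ... | a , b , a≢b , (Pa , a-free) , (Pb , b-free) with a ≟ u
  ...   | yes refl = b , a≢b ∘ sym , Pb , b-free
  ...   | no  a≢u  = a , a≢u , Pa , a-free

  greedy : ∀ D → (∀ {v} → P v → D ≤ degree v) → D + D ≤ length vertices → ∀ k → k ≤ D → Matching k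
  greedy D degree≥D enough zero    _   = empty
  greedy D degree≥D enough (suc k) k<D = grow (greedy D degree≥D enough k (<⇒≤ k<D))
    where
    2k+2≤2D : suc (suc (k + k)) ≤ D + D
    2k+2≤2D = subst (_≤ D + D) (cong suc (+-suc k k)) (+-mono-≤ k<D k<D)
    grow : Matching k → Matching (suc k)
    grow M =
      let u , w , u≢w , (Pu , u-free) , (Pw , w-free) = two-unmatched M (≤-trans 2k+2≤2D enough)
      in  augment M u-free w-free u≢w Pu Pw (<-≤-trans (+-mono-< k<D k<D) (+-mono-≤ (degree≥D Pu) (degree≥D Pw)))

  Matching⇒Contains : ∀ {s} → Matching s → Contains (M s) G
  Matching⇒Contains {s} N = [ x N , y N ] ∘ splitAt s , injective , preserves
    where
    ends-injective : Injective _≡_ _≡_ [ x N , y N ]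
    ends-injective {inj₁ a} {inj₁ b} eq = cong inj₁ (x-injective N eq)
    ends-injective {inj₂ a} {inj₂ b} eq = cong inj₂ (y-injective N eq)
    ends-injective {inj₁ a} {inj₂ b} eq = ⊥-elim (x≢y N a b eq)
    ends-injective {inj₂ a} {inj₁ b} eq = ⊥-elim (x≢y N b a (sym eq))
    injective : Injective _≡_ _≡_ ([ x N , y N ] ∘ splitAt s)
    injective {i} {j} eq =
      trans (sym (join-splitAt s s i)) (trans (cong (join s s) (ends-injective {splitAt s i} {splitAt s j} eq)) (join-splitAt s s j))
    preserves : ∀ i j → adj (M s) i j ≡ true → [ x N , y N ] (splitAt s i) ~ [ x N , y N ] (splitAt s j)
    preserves i j e with M-edge⁻ s {i} {j} e
    ... | a , inj₁ (refl , refl) rewrite splitAt-↑ˡ s a s | splitAt-↑ʳ s s a = edge N a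
    ... | a , inj₂ (refl , refl) rewrite splitAt-↑ˡ s a s | splitAt-↑ʳ s s a = ~-sym (edge N a)

module Copies {h n} (H : Graph h) (G : Graph n) where

  open Support H G public
  open Matchings G InCopy inCopy? public

  H-neighbours : Fin h → List (Fin h)
  H-neighbours i = filterᵇ (adj H i) (allFin h)

  module _ (φ : Vec (Fin n) h) (emb : IsEmbedding H G (lookup φ)) (i : Fin h) where

    neighbour-images-unique : Unique (map (lookup φ) (H-neighbours i))
    neighbour-images-unique = Unique.map⁺ (proj₁ emb) (Unique.filter⁺ _ (Unique.allFin⁺ h))

    neighbour-images⊆ : map (lookup φ) (H-neighbours i) ⊆ neighbours (lookup φ i)
    neighbour-images⊆ v∈ with ∈-map⁻ (lookup φ) v∈
    ... | j , j∈ , refl = ∈-neighbours⁺ (embedding⇒InCopy φ emb j)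
                            (proj₂ emb i j (Equivalence.to T-≡ (proj₂ (∈-filter⁻ (T? ∘ adj H i) {xs = allFin h} j∈))))

    deg≤degree : deg H i ≤ degree (lookup φ i)
    deg≤degree = subst (_≤ degree (lookup φ i)) (length-map (lookup φ) (H-neighbours i))
      (Unique⇒length≤ neighbour-images-unique neighbour-images⊆)

  degree-bound : ∀ {d} → (∀ i → d ≤ deg H i) → ∀ {v} → InCopy v → d ≤ degree v
  degree-bound d≤deg c with InCopy⇒embedding c
  ... | φ , emb , i , refl = ≤-trans (d≤deg i) (deg≤degree φ emb i)

  few-vertices⇒numCopies≤K : ∀ {m} → 0 < m → length vertices ≤ m → numCopies H G ≤ numCopies H (K m)
  few-vertices⇒numCopies≤K {m} 0<m few = numCopies-mono (K m) position
    (λ cu cv → position-injective (support∈vertices cu) (support∈vertices cv))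
    (λ cu cv e → K-adj⁺ (~-irrefl e ∘ position-injective (support∈vertices cu) (support∈vertices cv)))
    where
    open Position vertices few 0<m
    support∈vertices : ∀ {v} → InCopy v → v ∈ vertices
    support∈vertices c = ∈-filter⁺ inCopy? (∈-allFin _) c

  numCopies≤K : ∀ s {m} → suc m ≡ s + s → 0 < m → ¬ Contains (M s) G → (∀ i → s ≤ deg H i) →
    numCopies H G ≤ numCopies H (K m)
  numCopies≤K s {m} m+1≡2s 0<m M-free s≤deg with length vertices ≤? m
  ... | yes few  = few-vertices⇒numCopies≤K 0<m few
  ... | no  many = ⊥-elim (M-free (Matching⇒Contains (greedy s (degree-bound s≤deg) 2s≤ s ≤-refl)))
    where
    2s≤ : s + s ≤ length vertices
    2s≤ = subst (_≤ length vertices) m+1≡2s (≰⇒> many)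

  module OneLowDegreeVertex (t : ℕ) (v₀ : Fin h) (deg-v₀ : deg H v₀ ≡ t) (deg>t : ∀ i → i ≢ v₀ → suc t ≤ deg H i)
                            (M-free : ¬ Contains (M (suc t)) G) where

    private
      s : ℕ
      s = suc t

    no-s-matching : ¬ Matching s
    no-s-matching = M-free ∘ Matching⇒Contains

    degree≥t : ∀ {v} → InCopy v → t ≤ degree v
    degree≥t = degree-bound (λ i → deg≥t i)
      where
      deg≥t : ∀ i → t ≤ deg H i
      deg≥t i with i ≟ v₀
      ... | yes refl = ≤-reflexive (sym deg-v₀)
      ... | no  i≢v₀ = <⇒≤ (deg>t i i≢v₀)

    module LargeSupport (many : s + s ≤ length vertices) where

      enough : suc (suc (t + t)) ≤ length vertices
      enough = subst (_≤ length vertices) (cong suc (+-suc t t)) many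

      unmatched-degree≤t : ∀ (N : Matching t) {u} → InCopy u → Unmatched N u → degree u ≤ t
      unmatched-degree≤t N {u} Pu u-free = ≮⇒≥ λ t<degree →
        let w , w≢u , Pw , w-free = another-unmatched N enough u
        in  no-s-matching (augment N u-free w-free (w≢u ∘ sym) Pu Pw (+-mono-<-≤ t<degree (degree≥t Pw)))

      unmatched-neighbour-degree>t : ∀ (N : Matching t) {u z} → InCopy u → Unmatched N u → InCopy z → u ~ z →
        t < degree z
      -- Having at most t neighbours, u can only be an image of v₀; if z were not the image of a
      -- neighbour of v₀, u would have t + 1 neighbours.
      unmatched-neighbour-degree>t N {u} {z} Pu u-free Pz u~z with InCopy⇒embedding Pu
      ... | φ , emb , j₀ , refl with j₀ ≟ v₀
      ...   | no j₀≢v₀ =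
        ⊥-elim (<⇒≱ (<-≤-trans (deg>t j₀ j₀≢v₀) (deg≤degree φ emb j₀)) (unmatched-degree≤t N Pu u-free))
      ...   | yes refl with any? (λ j → (adj H v₀ j Bool.≟ true) ×-dec (lookup φ j ≟ z))
      ...     | yes (j , v₀~j , refl) = <-≤-trans (deg>t j (λ { refl → false≢true (trans (sym (irrefl H v₀)) v₀~j) }))
                                                   (deg≤degree φ emb j)
      ...     | no  z∉images = ⊥-elim (<⇒≱ t<degree (unmatched-degree≤t N Pu u-free))
        where
        t<degree : t < degree (lookup φ v₀)
        t<degree = subst (λ d → suc d ≤ degree (lookup φ v₀)) (trans (length-map (lookup φ) (H-neighbours v₀)) deg-v₀)
          (Unique⇒length≤ (All.tabulate z∉ ∷ neighbour-images-unique φ emb v₀) z∷images⊆)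
          where
          z∉ : ∀ {w} → w ∈ map (lookup φ) (H-neighbours v₀) → z ≢ w
          z∉ w∈ refl with ∈-map⁻ (lookup φ) w∈
          ... | j , j∈ , z≡φj =
            z∉images (j , Equivalence.to T-≡ (proj₂ (∈-filter⁻ (T? ∘ adj H v₀) {xs = allFin h} j∈)) , sym z≡φj)
          z∷images⊆ : z ∷ map (lookup φ) (H-neighbours v₀) ⊆ neighbours (lookup φ v₀)
          z∷images⊆ (here refl) = ∈-neighbours⁺ Pz u~z
          z∷images⊆ (there w∈)  = neighbour-images⊆ φ emb v₀ w∈

      unmatched-not-adjacent-to-both-ends : ∀ (N : Matching t) {u} → InCopy u → Unmatched N u →
        ∀ {i} → u ~ x N i → ¬ u ~ y N i
      unmatched-not-adjacent-to-both-ends N {u} Pu u-free {i} u~xi u~yi =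
        <⇒≱ (unmatched-neighbour-degree>t N Pu u-free (Py N i) u~yi) (unmatched-degree≤t N′ (Py N i) frees)
        where
        open Rematch N i u-free (~-sym u~xi) Pu renaming (matching to N′)

      unmatched-adjacent-to-an-end : ∀ (N : Matching t) {u} → InCopy u → Unmatched N u → ∀ i → u ~ x N i ⊎ u ~ y N i
      unmatched-adjacent-to-an-end N {u} Pu u-free i with u ~? x N i | u ~? y N i
      ... | yes u~xi | _        = inj₁ u~xi
      ... | no _     | yes u~yi = inj₂ u~yi
      ... | no u≁xi  | no u≁yi  = ⊥-elim (<⇒≱ (begin-strict
        degree u                                  ≤⟨ degree≤hits N u saturated ⟩
        length (xHits N u) + length (yHits N u)   <⟨ length-filter-disjoint< (λ j → u ~? x N j) (λ j → u ~? y N j)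
                                                        (unmatched-not-adjacent-to-both-ends N Pu u-free) i u≁xi u≁yi ⟩
        t                                         ∎) (degree≥t Pu))
        where
        open ≤-Reasoning
        saturated : ∀ {z} → InCopy z → u ~ z → ¬ Unmatched N z
        saturated Pz u~z z-free = no-s-matching (extend N u-free z-free u~z Pu Pz)

      orient-towards : ∀ (N : Matching t) {u} → InCopy u → Unmatched N u →
        Σ (Matching t) λ N′ → Unmatched N′ u × (∀ i → u ~ x N′ i)
      orient-towards N {u} Pu u-free = reorient N away , reorient-unmatched N away u-free , u~x
        where
        away : Fin t → Bool
        away i = not (adj G u (x N i))
        u~x : ∀ i → u ~ x (reorient N away) i
        u~x i with adj G u (x N i) in u~xi | unmatched-adjacent-to-an-end N Pu u-free i
        ... | true  | _             = u~xi
        ... | false | inj₁ false≡true = ⊥-elim (false≢true false≡true)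
        ... | false | inj₂ u~yi       = u~yi

      -- Maximum, since G has no matching of size s.
      maximum-matching : Matching t
      maximum-matching = greedy t degree≥t (≤-trans (n≤1+n _) (≤-trans (n≤1+n _) enough)) t ≤-refl

      module Structure (N : Matching t) {u₀} (Pu₀ : InCopy u₀) (u₀-free : Unmatched N u₀) (u₀~x : ∀ i → u₀ ~ x N i) where

        unmatched≁y : ∀ {z} i → InCopy z → Unmatched N z → ¬ z ~ y N i
        unmatched≁y {z} i Pz z-free z~yi with z ≟ u₀
        ... | yes refl = unmatched-not-adjacent-to-both-ends N Pu₀ u₀-free (u₀~x i) z~yi
        ... | no  z≢u₀ = no-s-matching (cross N i z-free u₀-free z≢u₀ (~-sym (u₀~x i)) z~yi Pz Pu₀)

        unmatched~x : ∀ {w} j → InCopy w → Unmatched N w → w ~ x N j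
        unmatched~x j Pw w-free with unmatched-adjacent-to-an-end N Pw w-free j
        ... | inj₁ w~xj = w~xj
        ... | inj₂ w~yj = ⊥-elim (unmatched≁y j Pw w-free w~yj)

        -- Rematching x i to u₀ frees y i, and then y i – y j – x j – w is an augmenting path.
        y≁y : ∀ {i j} → i ≢ j → ¬ y N i ~ y N j
        y≁y {i} {j} i≢j yi~yj =
          let w , w≢u₀ , Pw , w-free = another-unmatched N enough u₀
          in  no-s-matching (cross N′ j frees (keeps w-free (w≢u₀ ∘ sym)) (proj₂ (w-free i))
                (~-sym (unmatched~x j Pw w-free)) (subst (y N i ~_) (sym (y-unchanged (i≢j ∘ sym))) yi~yj) (Py N i) Pw)
          where
          open Rematch N i u₀-free (~-sym (u₀~x i)) Pu₀ renaming (matching to N′)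

        X : Fin n → Set
        X v = Σ (Fin t) λ i → x N i ≡ v

        X? : Decidable X
        X? v = any? (λ i → x N i ≟ v)

        edge-meets-X : ∀ {z z′} → InCopy z → InCopy z′ → z ~ z′ → X z ⊎ X z′
        edge-meets-X {z} {z′} Pz Pz′ z~z′ with matched-or-unmatched N z | matched-or-unmatched N z′
        ... | inj₂ (i , inj₁ xi≡z) | _                      = inj₁ (i , xi≡z)
        ... | _                    | inj₂ (j , inj₁ xj≡z′)  = inj₂ (j , xj≡z′)
        ... | inj₁ z-free          | inj₁ z′-free           = ⊥-elim (no-s-matching (extend N z-free z′-free z~z′ Pz Pz′))
        ... | inj₁ z-free          | inj₂ (j , inj₂ refl)   = ⊥-elim (unmatched≁y j Pz z-free z~z′)
        ... | inj₂ (i , inj₂ refl) | inj₁ z′-free           = ⊥-elim (unmatched≁y i Pz′ z′-free (~-sym z~z′))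
        ... | inj₂ (i , inj₂ refl) | inj₂ (j , inj₂ refl) with i ≟ j
        ...   | yes refl = ⊥-elim (~-irrefl z~z′ refl)
        ...   | no  i≢j  = ⊥-elim (y≁y i≢j z~z′)

        numCopies≤Hnka : ∀ k → numCopies H G ≤ numCopies H (Hnka n k t)
        numCopies≤Hnka k = numCopies-mono (Hnka n k t) position injective preserves
          where
          rest : List (Fin n)
          rest = filter (λ v → inCopy? v ×-dec ¬? (X? v)) (allFin n)
          order : List (Fin n)
          order = List.tabulate (x N) ++ rest
          order-unique : Unique order
          order-unique = Unique.++⁺ (Unique.tabulate⁺ (x-injective N)) (Unique.filter⁺ _ (Unique.allFin⁺ n))
            (λ { (v∈xs , v∈rest) →
                 proj₂ (proj₂ (∈-filter⁻ _ {xs = allFin n} v∈rest)) (Product.map₂ sym (∈-tabulate⁻ v∈xs)) })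
          open Position order (Unique-Fin⇒length≤ order-unique) (≤-<-trans z≤n (toℕ<n u₀))
          support⊆order : ∀ {v} → InCopy v → v ∈ order
          support⊆order {v} c with X? v
          ... | yes (i , refl) = ∈-++⁺ˡ (∈-tabulate⁺ i)
          ... | no  v∉X        = ∈-++⁺ʳ _ (∈-filter⁺ _ (∈-allFin v) (c , v∉X))
          position-X : ∀ {v} → X v → toℕ (position v) < t
          position-X (i , refl) = subst (toℕ (position (x N i)) <_) (length-tabulate (x N))
            (position-prefix (List.tabulate (x N)) refl (∈-tabulate⁺ i)
              (λ v∈rest → proj₂ (proj₂ (∈-filter⁻ _ {xs = allFin n} v∈rest)) (i , refl)))
          injective : ∀ {u v} → InCopy u → InCopy v → position u ≡ position v → u ≡ v
          injective cu cv = position-injective (support⊆order cu) (support⊆order cv)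
          preserves : ∀ {u v} → InCopy u → InCopy v → u ~ v → adj (Hnka n k t) (position u) (position v) ≡ true
          preserves cu cv u~v = [ (λ Xu → Hnka-adj⁺ n k t (position-X Xu) (~-irrefl u~v ∘ injective cu cv))
                                , (λ Xv → trans (Graph.sym (Hnka n k t) _ _)
                                                (Hnka-adj⁺ n k t (position-X Xv) (~-irrefl (~-sym u~v) ∘ injective cv cu)))
                                ]′ (edge-meets-X cu cv u~v)

      numCopies≤Hnka : ∀ k → numCopies H G ≤ numCopies H (Hnka n k t)
      numCopies≤Hnka k =
        let u₀ , _ , _ , (Pu₀ , u₀-free) , _ = two-unmatched maximum-matching enough
            N , u₀-free′ , u₀~x              = orient-towards maximum-matching Pu₀ u₀-free
        in  Structure.numCopies≤Hnka N Pu₀ u₀-free′ u₀~x k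

    numCopies≤Hnka⊔K : ∀ k {m} → suc m ≡ s + s → 0 < m → numCopies H G ≤ numCopies H (Hnka n k t) ⊔ numCopies H (K m)
    numCopies≤Hnka⊔K k {m} m+1≡2s 0<m with length vertices ≤? m
    ... | yes few  = ≤-trans (few-vertices⇒numCopies≤K 0<m few) (m≤n⊔m _ _)
    ... | no  more = ≤-trans (LargeSupport.numCopies≤Hnka (subst (_≤ length vertices) m+1≡2s (≰⇒> more)) k) (m≤m⊔n _ _)

module Extremal (t n : ℕ) (m≤n : 2 * suc t ∸ 1 ≤ n) where

  s m : ℕ
  s = suc t
  m = 2 * s ∸ 1

  m≡1+2t : m ≡ suc (t + t)
  m≡1+2t = trans (cong (λ a → t + suc a) (+-identityʳ t)) (+-suc t t)

  m+1≡2s : suc m ≡ s + s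
  m+1≡2s = cong suc (trans m≡1+2t (sym (+-suc t t)))

  0<m : 0 < m
  0<m = subst (0 <_) (sym m≡1+2t) (s≤s z≤n)

  n≤1+end : n ≤ suc (t + ((n ∸ m) + t))
  n≤1+end = ≤-reflexive (sym (begin
    suc (t + ((n ∸ m) + t)) ≡⟨ solve 2 (λ d a → con 1 :+ (a :+ (d :+ a)) := d :+ (con 1 :+ (a :+ a))) refl (n ∸ m) t ⟩
    (n ∸ m) + suc (t + t)   ≡⟨ cong ((n ∸ m) +_) m≡1+2t ⟨
    (n ∸ m) + m             ≡⟨ m∸n+n≡m m≤n ⟩
    n                       ∎))
    where
    open ≡-Reasoning
    open +-*-Solver

  paddedClique-M-free : ¬ Contains (M s) (paddedClique n m)
  paddedClique-M-free = M-free-if-edges-below s m (paddedClique n m) paddedClique-adj⁻ (≤-reflexive m+1≡2s)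

  Hnka-M-free : ¬ Contains (M s) (Hnka n m t)
  Hnka-M-free = M-free-if-covered s t (Hnka n m t) (Hnka-cover n m t n≤1+end) ≤-refl

  module _ {h} (H : Graph h) where

    isEx-K : (∀ v → s ≤ deg H v) → IsEx n H (M s) (numCopies H (K m))
    isEx-K s≤deg = upper , paddedClique n m , paddedClique-M-free ,
      ≤-antisym (upper (paddedClique n m) paddedClique-M-free) (numCopies-K≤paddedClique H m≤n)
      where
      upper : ∀ G → ¬ Contains (M s) G → numCopies H G ≤ numCopies H (K m)
      upper G M-free = Copies.numCopies≤K H G s m+1≡2s 0<m M-free s≤deg

    isEx-Hnka⊔K : ∀ v₀ → deg H v₀ ≡ t → (∀ v → v ≢ v₀ → s ≤ deg H v) →
      IsEx n H (M s) (numCopies H (Hnka n m t) ⊔ numCopies H (K m))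
    isEx-Hnka⊔K v₀ deg-v₀ s≤deg = upper , attained
      where
      upper : ∀ G → ¬ Contains (M s) G → numCopies H G ≤ numCopies H (Hnka n m t) ⊔ numCopies H (K m)
      upper G M-free = Copies.OneLowDegreeVertex.numCopies≤Hnka⊔K H G t v₀ deg-v₀ s≤deg M-free m m+1≡2s 0<m
      attained : Σ (Graph n) λ G → ¬ Contains (M s) G × numCopies H G ≡ numCopies H (Hnka n m t) ⊔ numCopies H (K m)
      attained with numCopies H (K m) ≤? numCopies H (Hnka n m t)
      ... | yes K≤Hnka = Hnka n m t , Hnka-M-free , sym (m≥n⇒m⊔n≡m K≤Hnka)
      ... | no  K≰Hnka = paddedClique n m , paddedClique-M-free ,
        ≤-antisym (upper (paddedClique n m) paddedClique-M-free)
                  (subst (_≤ numCopies H (paddedClique n m)) (sym (m≤n⇒m⊔n≡n (<⇒≤ (≰⇒> K≰Hnka))))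
                         (numCopies-K≤paddedClique H m≤n))

mainTheorem8 : (s n : ℕ) → 1 ≤ s → 2 * s ∸ 1 ≤ n → (h : ℕ) (H : Graph h) →
    ((∀ v → s ≤ deg H v) →
      IsEx n H (M s) (numCopies H (K (2 * s ∸ 1))))
    × ((Σ (Fin h) λ v₀ → deg H v₀ ≡ s ∸ 1 × (∀ v → v ≢ v₀ → s ≤ deg H v)) →
      IsEx n H (M s)
        (numCopies H (Hnka n (2 * s ∸ 1) (s ∸ 1)) ⊔ numCopies H (K (2 * s ∸ 1))))
mainTheorem8 (suc t) n (s≤s z≤n) m≤n h H =
  isEx-K H , λ (v₀ , deg-v₀ , s≤deg) → isEx-Hnka⊔K H v₀ deg-v₀ s≤deg
  where open Extremal t n m≤n
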